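{- For integers $m\ge 1$ and $n\ge 2m+3$, $R_{\pi}(K_{1,m},P_n)=n$.
   Context: All graphs are finite and simple. For graphs $F,G,H$, write $F\rightarrow(G,H)$ if every red-blue coloring of the edges of $F$ contains a red copy of $G$ or a blue copy of $H$. The Ramsey number $R(G,H)$ is the smallest $r$ with $K_r\rightarrow(G,H)$. $P_k$ is the path on $k$ vertices, and $K_r\setminus P_k$ denotes $K_r$ with the edges of a path on $k$ vertices ($k\le r$) deleted. The path-critical Ramsey number is $R_{\pi}(G,H)=\max\{k: K_r\setminus P_k\rightarrow(G,H)\}$ where $r=R(G,H)$. $K_{1,m}$ is the star with $m$ leaves. -}

module Defs where

open import Data.Nat using (ℕ; zero; suc; _<_; _≤_)
open import Data.Fin using (Fin; toℕ) renaming (zero to fzero; suc to fsuc)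
open import Data.Product using (Σ; _×_)
open import Data.Sum using (_⊎_)
open import Relation.Nullary using (¬_)
open import Relation.Binary.PropositionalEquality using (_≡_; _≢_)
open import Function.Definitions using (Injective)

Graph : ℕ → Set₁
Graph n = Fin n → Fin n → Set

Consec : ℕ → ℕ → Set
Consec a b = suc a ≡ b ⊎ suc b ≡ a

K : (r : ℕ) → Graph r
K r u v = u ≢ v

P : (n : ℕ) → Graph n
P n u v = Consec (toℕ u) (toℕ v)

Star : (m : ℕ) → Graph (suc m)
Star m u v = (u ≡ fzero × v ≢ fzero) ⊎ (v ≡ fzero × u ≢ fzero)

-- K_r \ P_k : delete the edges of the path 0-1-…-(k-1) from K_r (meaningful for k ≤ r).
KminusP : (r k : ℕ) → Graph r
KminusP r k u v = u ≢ v × ¬ (toℕ u < k × toℕ v < k × Consec (toℕ u) (toℕ v))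

data Colour : Set where
  red blue : Colour

-- A red-blue colouring of the edges of a graph on Fin r (symmetric in its arguments;
-- values on non-edges are irrelevant).
Colouring : ℕ → Set
Colouring r = Fin r → Fin r → Colour

SymColouring : {r : ℕ} → Colouring r → Set
SymColouring c = ∀ u v → c u v ≡ c v u

MonoCopy : {r a : ℕ} → Graph r → Colouring r → Colour → Graph a → Set
MonoCopy {r} {a} F c col G =
  Σ (Fin a → Fin r) λ φ → Injective _≡_ _≡_ φ ×
    (∀ i j → G i j → F (φ i) (φ j) × c (φ i) (φ j) ≡ col)

Arrows : {r a b : ℕ} → Graph r → Graph a → Graph b → Set
Arrows {r} F G H =
  (c : Colouring r) → SymColouring c → MonoCopy F c red G ⊎ MonoCopy F c blue H

IsRamseyNumber : {a b : ℕ} → Graph a → Graph b → ℕ → Set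
IsRamseyNumber G H r = Arrows (K r) G H × (∀ s → s < r → ¬ Arrows (K s) G H)

IsPathCriticalRamsey : {a b : ℕ} → Graph a → Graph b → ℕ → Set
IsPathCriticalRamsey G H k =
  Σ ℕ λ r → IsRamseyNumber G H r ×
    (k ≤ r × Arrows (KminusP r k) G H ×
      (∀ k' → k < k' → k' ≤ r → ¬ Arrows (KminusP r k') G H))

-- In a red-blue colouring of K_n minus a Hamiltonian path with no red K_{1,m}, every vertex
-- misses at most two vertices and has fewer than m red neighbours, so its blue degree is at
-- least n - m - 2 >= (n - 1)/2. Such a graph has a Hamiltonian path (Dirac, Ore): grow a
-- path one vertex at a time; if neither end x, z has a neighbour off the path, then, since
-- deg x + deg z >= n - 1 exceeds the number of path edges, some path edge a-b has z ~ a and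
-- x ~ b, which closes the path into a cycle, and a vertex off the path adjacent to the cycle
-- gives a longer path. As K_n contains K_n minus the path, and the all-blue K_{n-1} has
-- neither a red star nor a path on n vertices, R(K_{1,m}, P_n) = n, so R_pi = n, the largest
-- admissible k.
module Submission where

open import Defs
open import Level using (Level)
import Data.Nat as ℕ
open import Data.Nat using (ℕ; zero; suc; _+_; _*_; _≤_; _<_; _≤?_; _<?_; z≤n; s≤s)
open import Data.Nat.Properties
  using (≤-refl; ≤-trans; ≤-reflexive; ≤-pred; <⇒≤; <⇒≱; ≰⇒>; <-irrefl; n≤1+n; suc-injective;
         +-suc; +-comm; +-mono-≤; +-monoˡ-≤; +-monoʳ-≤; +-cancelˡ-≤; module ≤-Reasoning)
open import Data.Nat.Tactic.RingSolver using (solve-∀)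
open import Data.Fin using (Fin; toℕ; fromℕ<; inject≤; _≟_) renaming (zero to fzero; suc to fsuc)
open import Data.Fin.Properties using (any?; toℕ-injective; inject≤-injective; injective⇒≤)
open import Data.List
  using (List; []; _∷_; [_]; _++_; _∷ʳ_; _ʳ++_; length; head; last; lookup; reverse; filter; allFin;
         initLast; _∷ʳ′_)
open import Data.List.Properties using (length-++; length-++-sucʳ; length-tabulate; ++-assoc; ++-ʳ++; ʳ++-defn)
open import Data.List.Membership.Propositional using (_∈_; _∉_; find)
open import Data.List.Membership.Propositional.Properties
  using (∈-lookup; ∈-∃++; ∈-++⁻; ∈-++⁺ˡ; ∈-++⁺ʳ; ∈-allFin; ∈-filter⁺; ∈-filter⁻)
import Data.List.Membership.DecPropositional as DecMembership
open import Data.List.Relation.Binary.Subset.Propositional using (_⊆_)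
open import Data.List.Relation.Binary.Disjoint.Propositional using (Disjoint)
open import Data.List.Relation.Binary.Permutation.Propositional
  using (_↭_; ↭-sym; ↭-trans; ↭-reflexive; ↭⇒↭ₛ)
open import Data.List.Relation.Binary.Permutation.Propositional.Properties
  using (∈-resp-↭; ↭-length; ++-comm; ++⁺ʳ; shift; ↭-reverse; ∷↭∷ʳ)
import Data.List.Relation.Binary.Permutation.Setoid.Properties as PermutationSetoid
open import Data.List.Relation.Unary.Any as Any using (here; there)
import Data.List.Relation.Unary.All as All
open All using (All; [])
open import Data.List.Relation.Unary.All.Properties using (¬Any⇒All¬)
open import Data.List.Relation.Unary.Unique.Propositional using (Unique; []; _∷_)
import Data.List.Relation.Unary.Unique.Propositional.Properties as Unique
open import Data.List.Relation.Unary.Linked as Linked using (Linked; []; [-]; _∷_; _∷′_; head′)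
import Data.List.Relation.Unary.Linked.Properties as Linked
open import Data.Maybe using (just)
open import Data.Maybe.Relation.Binary.Connected as Connected using (Connected)
import Data.Product as Product
open import Data.Product using (Σ; ∃; ∃₂; _×_; _,_; proj₁; proj₂)
import Data.Sum as Sum
open import Data.Sum using (_⊎_; inj₁; inj₂)
open import Data.Empty using (⊥-elim)
open import Function using (_∘_)
open import Function.Definitions using (Injective)
open import Relation.Binary.Core using (Rel)
import Relation.Binary.Definitions as B
open import Relation.Binary.Definitions using (Symmetric; Irreflexive)
import Relation.Binary.PropositionalEquality as ≡
open import Relation.Binary.PropositionalEquality
  using (_≡_; _≢_; refl; sym; trans; cong; subst; module ≡-Reasoning)
open import Relation.Unary as U using (Pred)
open import Relation.Nullary using (¬_; Dec; yes; no; contradiction; ¬?)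
open import Relation.Nullary.Decidable using (decidable-stable; _×-dec_; _⊎-dec_)

private
  variable
    a ℓ : Level
    A : Set a

-- Duplicate-free lists

unique-⊆⇒length≤ : ∀ {xs ys : List A} → Unique xs → xs ⊆ ys → length xs ≤ length ys
unique-⊆⇒length≤ {xs = []} _ _ = z≤n
unique-⊆⇒length≤ {xs = x ∷ xs} (x∉xs ∷ xs!) xs⊆ys
  with ys₁ , ys₂ , refl ← ∈-∃++ (xs⊆ys (here refl)) =
  ≤-trans (s≤s (unique-⊆⇒length≤ xs! xs⊆ys₁++ys₂)) (≤-reflexive (sym (length-++-sucʳ ys₁ x ys₂)))
  where
  xs⊆ys₁++ys₂ : xs ⊆ ys₁ ++ ys₂
  xs⊆ys₁++ys₂ v∈xs with ∈-++⁻ ys₁ (xs⊆ys (there v∈xs))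
  ... | inj₁ v∈ys₁         = ∈-++⁺ˡ v∈ys₁
  ... | inj₂ (here refl)   = ⊥-elim (All.lookup x∉xs v∈xs refl)
  ... | inj₂ (there v∈ys₂) = ∈-++⁺ʳ ys₁ v∈ys₂

length-allFin : ∀ n → length (allFin n) ≡ n
length-allFin n = length-tabulate {n = n} (λ i → i)

unique⇒length≤ : ∀ {n} {xs : List (Fin n)} → Unique xs → length xs ≤ n
unique⇒length≤ {n} {xs} xs! =
  subst (length xs ≤_) (length-allFin n) (unique-⊆⇒length≤ xs! (λ {v} _ → ∈-allFin v))

covering⇒length≥ : ∀ {n} {xs : List (Fin n)} → (∀ v → v ∈ xs) → n ≤ length xs
covering⇒length≥ {n} {xs} covers =
  subst (_≤ length xs) (length-allFin n) (unique-⊆⇒length≤ (Unique.allFin⁺ n) (λ {v} _ → covers v))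

Unique-resp-↭ : ∀ {xs ys : List A} → xs ↭ ys → Unique xs → Unique ys
Unique-resp-↭ σ = PermutationSetoid.Unique-resp-↭ (≡.setoid _) (↭⇒↭ₛ σ)

lookup-injective : ∀ {xs : List A} → Unique xs → ∀ {i j} → lookup xs i ≡ lookup xs j → i ≡ j
lookup-injective (x∉xs ∷ xs!) {fzero}  {fzero}  _  = refl
lookup-injective (x∉xs ∷ xs!) {fzero}  {fsuc j} eq = ⊥-elim (All.lookup x∉xs (∈-lookup j) eq)
lookup-injective (x∉xs ∷ xs!) {fsuc i} {fzero}  eq = ⊥-elim (All.lookup x∉xs (∈-lookup i) (sym eq))
lookup-injective (x∉xs ∷ xs!) {fsuc i} {fsuc j} eq = cong fsuc (lookup-injective xs! eq)

-- Paths and cycles as lists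

head-++-∷ : ∀ (xs : List A) {y ys} → head (xs ++ y ∷ ys) ≡ head (xs ∷ʳ y)
head-++-∷ []      = refl
head-++-∷ (_ ∷ _) = refl

last-++-∷ : ∀ (xs : List A) {y ys} → last (xs ++ y ∷ ys) ≡ last (y ∷ ys)
last-++-∷ []           = refl
last-++-∷ (_ ∷ [])     = refl
last-++-∷ (_ ∷ x ∷ xs) = last-++-∷ (x ∷ xs)

last-∷ʳ : ∀ (xs : List A) {y} → last (xs ∷ʳ y) ≡ just y
last-∷ʳ xs = last-++-∷ xs

length-∷ʳ : ∀ (xs : List A) {y} → length (xs ∷ʳ y) ≡ suc (length xs)
length-∷ʳ []       = refl
length-∷ʳ (_ ∷ xs) = cong suc (length-∷ʳ xs)

Cycle : Rel A ℓ → List A → Set _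
Cycle R xs = ∃₂ λ c cs → c ∷ cs ↭ xs × Linked R (c ∷ cs ∷ʳ c)

module _ {R : Rel A ℓ} where

  Linked-++⁻ˡ : ∀ xs {ys} → Linked R (xs ++ ys) → Linked R xs
  Linked-++⁻ˡ []           _        = []
  Linked-++⁻ˡ (x ∷ [])     _        = [-]
  Linked-++⁻ˡ (x ∷ y ∷ xs) (r ∷ rs) = r ∷ Linked-++⁻ˡ (y ∷ xs) rs

  Linked-++-∷⁺ : ∀ xs {v ys} → Linked R (xs ∷ʳ v) → Linked R (v ∷ ys) → Linked R (xs ++ v ∷ ys)
  Linked-++-∷⁺ []           _         rs = rs
  Linked-++-∷⁺ (x ∷ [])     (r ∷ [-]) rs = r ∷ rs
  Linked-++-∷⁺ (x ∷ y ∷ xs) (r ∷ rs₁) rs = r ∷ Linked-++-∷⁺ (y ∷ xs) rs₁ rs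

  Linked-++-∷⁻ : ∀ xs {v ys} → Linked R (xs ++ v ∷ ys) → Linked R (xs ∷ʳ v) × Linked R (v ∷ ys)
  Linked-++-∷⁻ []           rs       = [-] , rs
  Linked-++-∷⁻ (x ∷ [])     (r ∷ rs) = r ∷ [-] , rs
  Linked-++-∷⁻ (x ∷ y ∷ xs) (r ∷ rs) with rs₁ , rs₂ ← Linked-++-∷⁻ (y ∷ xs) rs = r ∷ rs₁ , rs₂

  Linked-lookup : ∀ {xs} → Linked R xs → ∀ i j → suc (toℕ i) ≡ toℕ j → R (lookup xs i) (lookup xs j)
  Linked-lookup (r ∷ _)  fzero    (fsuc fzero)    _  = r
  Linked-lookup (_ ∷ rs) (fsuc i) (fsuc j)        eq = Linked-lookup rs i j (suc-injective eq)
  Linked-lookup [-]      fzero    fzero           ()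
  Linked-lookup (_ ∷ _)  fzero    fzero           ()
  Linked-lookup (_ ∷ _)  fzero    (fsuc (fsuc _)) ()

  cycle⇒path : ∀ {xs y} → Cycle R xs → y ∈ xs → ∃ λ ys → y ∷ ys ↭ xs × Linked R (y ∷ ys)
  cycle⇒path {y = y} (c , cs , σ , closed) y∈xs with ∈-resp-↭ (↭-sym σ) y∈xs
  ... | here refl = cs , σ , Linked-++⁻ˡ (c ∷ cs) closed
  ... | there y∈cs
    with p , q , refl ← ∈-∃++ y∈cs
    with c⋯y , y⋯c ← Linked-++-∷⁻ (c ∷ p) (subst (λ l → Linked R (c ∷ l)) (++-assoc p (y ∷ q) [ c ]) closed)
    = q ++ c ∷ p , ↭-trans (++-comm (y ∷ q) (c ∷ p)) σ , Linked-++-∷⁺ (y ∷ q) y⋯c (Linked-++⁻ˡ (c ∷ p) c⋯y)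

  module _ (R-sym : Symmetric R) where

    Linked-ʳ++⁺ : ∀ xs {ys} → Linked R xs → Connected R (head xs) (head ys) → Linked R ys →
                  Linked R (xs ʳ++ ys)
    Linked-ʳ++⁺ []       _   _ rs = rs
    Linked-ʳ++⁺ (x ∷ xs) rxs c rs =
      Linked-ʳ++⁺ xs (Linked.tail rxs) (Connected.sym R-sym (head′ rxs)) (c ∷′ rs)

    chords⇒cycle : ∀ {x ms z} pre {a b post} → Linked R (x ∷ ms ∷ʳ z) →
                   x ∷ ms ∷ʳ z ≡ pre ++ a ∷ b ∷ post → R x b → R z a → Cycle R (x ∷ ms ∷ʳ z)
    chords⇒cycle {x} {ms} {z} pre {a} {b} {post} path split xb za
      with ⋯a , a⋯ ← Linked-++-∷⁻ pre (subst (Linked R) split path)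
      = a , reverse pre ++ b ∷ post , same-vertices ,
        subst (Linked R) closes (Linked-ʳ++⁺ (pre ∷ʳ a) ⋯a x–b (Linked.++⁺ (Linked.tail a⋯) z–a [-]))
      where
      x–b : Connected R (head (pre ∷ʳ a)) (just b)
      x–b = subst (λ h → Connected R h (just b)) (trans (cong head split) (head-++-∷ pre)) (Connected.just xb)
      z–a : Connected R (last (b ∷ post)) (just a)
      z–a = subst (λ l → Connected R l (just a))
              (trans (sym (last-∷ʳ (x ∷ ms))) (trans (cong last split) (last-++-∷ pre))) (Connected.just za)
      closes : (pre ∷ʳ a) ʳ++ (b ∷ post ∷ʳ a) ≡ a ∷ (reverse pre ++ b ∷ post) ∷ʳ a
      closes = begin
        (pre ∷ʳ a) ʳ++ (b ∷ post ∷ʳ a)      ≡⟨ ++-ʳ++ pre ⟩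
        a ∷ pre ʳ++ (b ∷ post ∷ʳ a)         ≡⟨ cong (a ∷_) (ʳ++-defn pre) ⟩
        a ∷ reverse pre ++ (b ∷ post ∷ʳ a)  ≡⟨ cong (a ∷_) (++-assoc (reverse pre) (b ∷ post) [ a ]) ⟨
        a ∷ (reverse pre ++ b ∷ post) ∷ʳ a  ∎
        where open ≡-Reasoning
      same-vertices : a ∷ reverse pre ++ b ∷ post ↭ x ∷ ms ∷ʳ z
      same-vertices = ↭-trans (↭-sym (shift a (reverse pre) (b ∷ post)))
                        (↭-trans (++⁺ʳ (a ∷ b ∷ post) (↭-reverse pre)) (↭-reflexive (sym split)))

module _ {p} {P Q : Pred A p} (P? : U.Decidable P) (Q? : U.Decidable Q) where

  CrossingPair : List A → Set _
  CrossingPair xs = ∃₂ λ pre post → ∃₂ λ a b → xs ≡ pre ++ a ∷ b ∷ post × Q a × P b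

  ∷-crossingPair : ∀ {x xs} → CrossingPair xs → CrossingPair (x ∷ xs)
  ∷-crossingPair {x} (pre , post , a , b , eq , qa , pb) =
    x ∷ pre , post , a , b , cong (x ∷_) eq , qa , pb

  -- The i-th entries of x ∷ ms and of ms ∷ʳ z form the i-th consecutive pair of x ∷ ms ∷ʳ z.
  crossingPair-pigeonhole : ∀ x ms z →
    suc (length ms) < length (filter Q? (x ∷ ms)) + length (filter P? (ms ∷ʳ z)) →
    CrossingPair (x ∷ ms ∷ʳ z)
  crossingPair-pigeonhole x [] z many with Q? x | P? z
  ... | yes qx | yes pz = [] , [] , x , z , refl , qx , pz
  ... | yes _  | no _   = contradiction many (<-irrefl refl)
  ... | no _   | yes _  = contradiction many (<-irrefl refl)
  ... | no _   | no _   = contradiction many λ ()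
  crossingPair-pigeonhole x (m ∷ ms) z many with Q? x | P? m
  ... | yes qx | yes pm = [] , ms ∷ʳ z , x , m , refl , qx , pm
  ... | yes _  | no _   = ∷-crossingPair (crossingPair-pigeonhole m ms z (≤-pred many))
  ... | no _   | yes _  = ∷-crossingPair (crossingPair-pigeonhole m ms z
                            (≤-pred (subst (suc (suc (length ms)) <_) (+-suc _ _) many)))
  ... | no _   | no _   = ∷-crossingPair (crossingPair-pigeonhole m ms z (≤-trans (n≤1+n _) many))

-- Hamiltonian paths under a degree-sum condition

module HamiltonianPath {n} {E : Rel (Fin n) ℓ} (E? : B.Decidable E)
                       (E-sym : Symmetric E) (E-irrefl : Irreflexive _≡_ E) where

  open DecMembership (_≟_ {n}) using (_∈?_)

  N : Fin n → List (Fin n)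
  N u = filter (E? u) (allFin n)

  deg : Fin n → ℕ
  deg u = length (N u)

  IsPath : List (Fin n) → Set ℓ
  IsPath xs = Linked E xs × Unique xs

  LongerPath : List (Fin n) → Set ℓ
  LongerPath xs = ∃ λ ys → IsPath ys × length ys ≡ suc (length xs)

  ∈N⇒E : ∀ {u v} → v ∈ N u → E u v
  ∈N⇒E {u} v∈N = proj₂ (∈-filter⁻ (E? u) {xs = allFin n} v∈N)

  ∈N⇒≢ : ∀ {u v} → v ∈ N u → u ≢ v
  ∈N⇒≢ v∈N u≡v = E-irrefl u≡v (∈N⇒E v∈N)

  ∷N-unique : ∀ u → Unique (u ∷ N u)
  ∷N-unique u = All.tabulate ∈N⇒≢ ∷ Unique.filter⁺ (E? u) {allFin n} (Unique.allFin⁺ n)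

  deg≤count : ∀ u {xs} → N u ⊆ xs → deg u ≤ length (filter (E? u) xs)
  deg≤count u N⊆xs = unique-⊆⇒length≤ (Unique.filter⁺ (E? u) {allFin n} (Unique.allFin⁺ n))
    (λ v∈N → ∈-filter⁺ (E? u) (N⊆xs v∈N) (∈N⇒E v∈N))

  deg<length : ∀ {u xs} → u ∈ xs → N u ⊆ xs → deg u < length xs
  deg<length u∈xs N⊆xs = unique-⊆⇒length≤ (∷N-unique _) λ where
    (here refl) → u∈xs
    (there v∈N) → N⊆xs v∈N

  outside-vertex : ∀ xs → length xs < n → ∃ λ w → w ∉ xs
  outside-vertex xs short with any? (λ w → ¬? (w ∈? xs))
  ... | yes found = found
  ... | no none   = contradiction
    (covering⇒length≥ λ w → decidable-stable (w ∈? xs) (λ w∉ → none (w , w∉))) (<⇒≱ short)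

  outward-neighbour? : ∀ u xs → (∃ λ w → E u w × w ∉ xs) ⊎ N u ⊆ xs
  outward-neighbour? u xs with any? (λ w → E? u w ×-dec ¬? (w ∈? xs))
  ... | yes found = inj₁ found
  ... | no none   = inj₂ λ {w} w∈N → decidable-stable (w ∈? xs) (λ w∉ → none (w , ∈N⇒E w∈N , w∉))

  ∷-path : ∀ {w y ys} → E w y → w ∉ y ∷ ys → IsPath (y ∷ ys) → IsPath (w ∷ y ∷ ys)
  ∷-path wy w∉ (linked , unique) = wy ∷ linked , ¬Any⇒All¬ _ w∉ ∷ unique

  ∷ʳ-path : ∀ {xs z w} → E z w → w ∉ xs ∷ʳ z → IsPath (xs ∷ʳ z) → IsPath (xs ∷ʳ z ∷ʳ w)
  ∷ʳ-path {xs} {z} {w} zw w∉ (linked , unique) =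
    subst (Linked E) (sym (++-assoc xs [ z ] [ w ])) (Linked-++-∷⁺ xs linked (zw ∷ [-])) ,
    Unique-resp-↭ (∷↭∷ʳ w (xs ∷ʳ z)) (¬Any⇒All¬ _ w∉ ∷ unique)

  module _ (degree-sum : ∀ u v → n ≤ suc (deg u + deg v)) where

    neighbour-in : ∀ {xs w x} → Unique xs → w ∉ xs → x ∈ xs → N x ⊆ xs → ∃ λ y → y ∈ xs × E w y
    neighbour-in {xs} {w} {x} xs! w∉xs x∈xs Nx⊆xs with Any.any? (E? w) xs
    ... | yes adjacent = find adjacent
    ... | no ¬adjacent = contradiction (degree-sum x w) (<⇒≱ too-large)
      where
      disjoint : Disjoint xs (w ∷ N w)
      disjoint (v∈xs , here refl) = w∉xs v∈xs
      disjoint (v∈xs , there v∈N) = ¬adjacent (Any.map (λ { refl → ∈N⇒E v∈N }) v∈xs)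
      too-large : suc (deg x + deg w) < n
      too-large = begin
        suc (suc (deg x + deg w))  ≡⟨ cong suc (+-suc (deg x) (deg w)) ⟨
        suc (deg x) + suc (deg w)  ≤⟨ +-monoˡ-≤ _ (deg<length x∈xs Nx⊆xs) ⟩
        length xs + suc (deg w)    ≡⟨ length-++ xs ⟨
        length (xs ++ w ∷ N w)     ≤⟨ unique⇒length≤ (Unique.++⁺ xs! (∷N-unique w) disjoint) ⟩
        n                          ∎
        where open ≤-Reasoning

    cycle⇒longerPath : ∀ {xs x} → Cycle E xs → Unique xs → length xs < n → x ∈ xs → N x ⊆ xs →
                       LongerPath xs
    cycle⇒longerPath {xs} cycle xs! short x∈xs Nx⊆xs
      with w , w∉xs ← outside-vertex xs short
      with y , y∈xs , wy ← neighbour-in xs! w∉xs x∈xs Nx⊆xs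
      with ys , σ , y⋯ ← cycle⇒path cycle y∈xs
      = w ∷ y ∷ ys , ∷-path wy (w∉xs ∘ ∈-resp-↭ σ) (y⋯ , Unique-resp-↭ (↭-sym σ) xs!) ,
        cong suc (↭-length σ)

    closed⇒cycle : ∀ x ms z → IsPath (x ∷ ms ∷ʳ z) → length (x ∷ ms ∷ʳ z) < n →
                   N x ⊆ x ∷ ms ∷ʳ z → N z ⊆ x ∷ ms ∷ʳ z → Cycle E (x ∷ ms ∷ʳ z)
    closed⇒cycle x ms z (path , _) short Nx⊆ Nz⊆ =
      let pre , post , a , b , split , za , xb = crossingPair-pigeonhole (E? x) (E? z) x ms z many
      in chords⇒cycle E-sym pre path split xb za
      where
      Nx⊆tail : N x ⊆ ms ∷ʳ z
      Nx⊆tail v∈N with Nx⊆ v∈N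
      ... | here refl    = ⊥-elim (∈N⇒≢ v∈N refl)
      ... | there v∈tail = v∈tail
      Nz⊆init : N z ⊆ x ∷ ms
      Nz⊆init v∈N with ∈-++⁻ (x ∷ ms) (Nz⊆ v∈N)
      ... | inj₁ v∈init      = v∈init
      ... | inj₂ (here refl) = ⊥-elim (∈N⇒≢ v∈N refl)
      many : suc (length ms) < length (filter (E? z) (x ∷ ms)) + length (filter (E? x) (ms ∷ʳ z))
      many = begin
        suc (suc (length ms))  ≡⟨ cong suc (length-∷ʳ ms) ⟨
        length (x ∷ ms ∷ʳ z)   ≤⟨ ≤-pred (≤-trans short (degree-sum x z)) ⟩
        deg x + deg z          ≡⟨ +-comm (deg x) (deg z) ⟩
        deg z + deg x          ≤⟨ +-mono-≤ (deg≤count z Nz⊆init) (deg≤count x Nx⊆tail) ⟩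
        length (filter (E? z) (x ∷ ms)) + length (filter (E? x) (ms ∷ʳ z)) ∎
        where open ≤-Reasoning

    longer-path : ∀ xs → IsPath xs → length xs < n → LongerPath xs
    longer-path [] _ 0<n = [ fromℕ< 0<n ] , ([-] , [] ∷ []) , refl
    longer-path (x ∷ ys) path short with outward-neighbour? x (x ∷ ys)
    ... | inj₁ (w , xw , w∉) = w ∷ x ∷ ys , ∷-path (E-sym xw) w∉ path , refl
    ... | inj₂ Nx⊆ with initLast ys
    ...   | [] = contradiction (≤-trans (degree-sum x x) (s≤s (+-mono-≤ isolated isolated))) (<⇒≱ short)
      where
      isolated : deg x ≤ 0
      isolated = ≤-pred (deg<length (here refl) Nx⊆)
    ...   | ms ∷ʳ′ z with outward-neighbour? z (x ∷ ms ∷ʳ z)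
    ...     | inj₁ (w , zw , w∉) =
      (x ∷ ms ∷ʳ z) ∷ʳ w , ∷ʳ-path {x ∷ ms} zw w∉ path , length-∷ʳ (x ∷ ms ∷ʳ z)
    ...     | inj₂ Nz⊆ =
      cycle⇒longerPath (closed⇒cycle x ms z path short Nx⊆ Nz⊆) (proj₂ path) short (here refl) Nx⊆

    path-of-length : ∀ k → k ≤ n → ∃ λ xs → IsPath xs × length xs ≡ k
    path-of-length zero    _   = [] , ([] , []) , refl
    path-of-length (suc k) k<n with xs , path , refl ← path-of-length k (<⇒≤ k<n) = longer-path xs path k<n

    hamiltonian-path : ∃ λ xs → IsPath xs × length xs ≡ n
    hamiltonian-path = path-of-length n ≤-refl

-- Ramsey arrows

Embedding : ∀ {a r} → Graph a → Rel (Fin r) ℓ → Set ℓ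
Embedding {a = a} {r} G R = Σ (Fin a → Fin r) λ φ → Injective _≡_ _≡_ φ × (∀ i j → G i j → R (φ i) (φ j))

module _ {r} {R : Rel (Fin r) ℓ} (R-sym : Symmetric R) where

  path-embedding : ∀ {xs} → Unique xs → Linked R xs → Embedding (P (length xs)) R
  path-embedding {xs} xs! linked = lookup xs , lookup-injective xs! , edge
    where
    edge : ∀ i j → P (length xs) i j → R (lookup xs i) (lookup xs j)
    edge i j (inj₁ i→j) = Linked-lookup linked i j i→j
    edge i j (inj₂ j→i) = R-sym (Linked-lookup linked j i j→i)

  star-embedding : ∀ {m u vs} → Irreflexive _≡_ R → Unique vs → All (R u) vs → m ≤ length vs →
                   Embedding (Star m) R
  star-embedding {m} {u} {vs} R-irrefl vs! spokes m≤ = φ , φ-injective , edge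
    where
    leaf : Fin m → Fin r
    leaf i = lookup vs (inject≤ i m≤)
    spoke : ∀ i → R u (leaf i)
    spoke i = All.lookup spokes (∈-lookup _)
    φ : Fin (suc m) → Fin r
    φ fzero    = u
    φ (fsuc i) = leaf i
    φ-injective : Injective _≡_ _≡_ φ
    φ-injective {fzero}  {fzero}  _  = refl
    φ-injective {fzero}  {fsuc j} eq = ⊥-elim (R-irrefl eq (spoke j))
    φ-injective {fsuc i} {fzero}  eq = ⊥-elim (R-irrefl (sym eq) (spoke i))
    φ-injective {fsuc i} {fsuc j} eq = cong fsuc (inject≤-injective m≤ m≤ i j (lookup-injective vs! eq))
    edge : ∀ i j → Star m i j → R (φ i) (φ j)
    edge fzero    fzero    (inj₁ (_ , 0≢0)) = ⊥-elim (0≢0 refl)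
    edge fzero    fzero    (inj₂ (_ , 0≢0)) = ⊥-elim (0≢0 refl)
    edge fzero    (fsuc j) _                = spoke j
    edge (fsuc i) fzero    _                = R-sym (spoke i)
    edge (fsuc _) (fsuc _) (inj₁ (() , _))
    edge (fsuc _) (fsuc _) (inj₂ (() , _))

degree-sum-bound : ∀ {m n r₁ r₂ b₁ b₂} → 2 * m + 3 ≤ n → r₁ < m → r₂ < m →
                   n ≤ 3 + (r₁ + b₁) → n ≤ 3 + (r₂ + b₂) → n ≤ suc (b₁ + b₂)
degree-sum-bound {m} {n} {r₁} {r₂} {b₁} {b₂} big r₁<m r₂<m n≤₁ n≤₂ = +-cancelˡ-≤ n n _ (begin
  n + n                              ≤⟨ +-mono-≤ n≤₁ n≤₂ ⟩
  (3 + (r₁ + b₁)) + (3 + (r₂ + b₂))  ≤⟨ +-mono-≤ (+-monoʳ-≤ 2 (+-monoˡ-≤ b₁ r₁<m)) (+-monoʳ-≤ 2 (+-monoˡ-≤ b₂ r₂<m)) ⟩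
  (2 + (m + b₁)) + (2 + (m + b₂))    ≡⟨ regroup m b₁ b₂ ⟩
  (2 * m + 3) + suc (b₁ + b₂)        ≤⟨ +-monoˡ-≤ _ big ⟩
  n + suc (b₁ + b₂)                  ∎)
  where
  open ≤-Reasoning
  regroup : ∀ m b₁ b₂ → (2 + (m + b₁)) + (2 + (m + b₂)) ≡ (2 * m + 3) + suc (b₁ + b₂)
  regroup = solve-∀

AtMostTwoNonNeighbours : ∀ {n} → Graph n → Set
AtMostTwoNonNeighbours F = ∀ u → ∃₂ λ a b → ∀ v → u ≢ v → a ≢ v → b ≢ v → F u v

_≟ᶜ_ : B.DecidableEquality Colour
red  ≟ᶜ red  = yes refl
red  ≟ᶜ blue = no λ ()
blue ≟ᶜ red  = no λ ()
blue ≟ᶜ blue = yes refl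

module RedBlue {n} {F : Graph n} (F? : B.Decidable F) (F-sym : Symmetric F) (F-irrefl : Irreflexive _≡_ F)
               (c : Colouring n) (c-sym : SymColouring c) where

  Coloured : Colour → Rel (Fin n) _
  Coloured col u v = F u v × c u v ≡ col

  Coloured? : ∀ col → B.Decidable (Coloured col)
  Coloured? col u v = F? u v ×-dec (c u v ≟ᶜ col)

  Coloured-sym : ∀ {col} → Symmetric (Coloured col)
  Coloured-sym {x = u} {y = v} (uv , colour) = F-sym uv , trans (c-sym v u) colour

  Coloured-irrefl : ∀ {col} → Irreflexive _≡_ (Coloured col)
  Coloured-irrefl u≡v = F-irrefl u≡v ∘ proj₁

  neighbours : Colour → Fin n → List (Fin n)
  neighbours col u = filter (Coloured? col u) (allFin n)

  degree-bound : AtMostTwoNonNeighbours F → ∀ u →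
                 n ≤ 3 + (length (neighbours red u) + length (neighbours blue u))
  degree-bound sparse u with a , b , adjacent ← sparse u =
    subst (n ≤_) (cong (3 +_) (length-++ (neighbours red u))) (covering⇒length≥ covered)
    where
    coloured : ∀ {v} → F u v → v ∈ neighbours red u ++ neighbours blue u
    coloured {v} uv with c u v in colour
    ... | red  = ∈-++⁺ˡ (∈-filter⁺ (Coloured? red u) (∈-allFin v) (uv , colour))
    ... | blue = ∈-++⁺ʳ (neighbours red u) (∈-filter⁺ (Coloured? blue u) (∈-allFin v) (uv , colour))
    covered : ∀ v → v ∈ u ∷ a ∷ b ∷ neighbours red u ++ neighbours blue u
    covered v with u ≟ v | a ≟ v | b ≟ v
    ... | yes refl | _        | _        = here refl
    ... | no _     | yes refl | _        = there (here refl)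
    ... | no _     | no _     | yes refl = there (there (here refl))
    ... | no u≢v   | no a≢v   | no b≢v   = there (there (there (coloured (adjacent v u≢v a≢v b≢v))))

  blue-degree-sum : ∀ {m} → AtMostTwoNonNeighbours F → 2 * m + 3 ≤ n →
                    (∀ u → length (neighbours red u) < m) →
                    ∀ u v → n ≤ suc (length (neighbours blue u) + length (neighbours blue v))
  blue-degree-sum sparse big few-red u v =
    degree-sum-bound big (few-red u) (few-red v) (degree-bound sparse u) (degree-bound sparse v)

  red-star-or-blue-path : ∀ {m} → AtMostTwoNonNeighbours F → 2 * m + 3 ≤ n →
                          MonoCopy F c red (Star m) ⊎ MonoCopy F c blue (P n)
  red-star-or-blue-path {m} sparse big with any? (λ u → m ≤? length (neighbours red u))
  ... | yes (u , m≤) = inj₁ (star-embedding Coloured-sym Coloured-irrefl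
                               (Unique.filter⁺ (Coloured? red u) {allFin n} (Unique.allFin⁺ n))
                               (All.tabulate λ v∈ → proj₂ (∈-filter⁻ (Coloured? red u) {xs = allFin n} v∈)) m≤)
  ... | no few-red
    with xs , (linked , xs!) , length≡n ←
         HamiltonianPath.hamiltonian-path (Coloured? blue) Coloured-sym Coloured-irrefl
           (blue-degree-sum sparse big λ u → ≰⇒> (few-red ∘ (u ,_)))
    = inj₂ (subst (λ k → MonoCopy F c blue (P k)) length≡n (path-embedding Coloured-sym xs! linked))

star-path-arrows : ∀ {m n} {F : Graph n} → B.Decidable F → Symmetric F → Irreflexive _≡_ F →
                   AtMostTwoNonNeighbours F → 2 * m + 3 ≤ n → Arrows F (Star m) (P n)
star-path-arrows F? F-sym F-irrefl sparse big c c-sym =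
  RedBlue.red-star-or-blue-path F? F-sym F-irrefl c c-sym sparse big

Arrows-⊆ : ∀ {r a b} {F F′ : Graph r} {G : Graph a} {H : Graph b} →
           (∀ u v → F u v → F′ u v) → Arrows F G H → Arrows F′ G H
Arrows-⊆ {F = F} {F′} F⊆F′ arrows c c-sym = Sum.map widen widen (arrows c c-sym)
  where
  widen : ∀ {k col} {G : Graph k} → MonoCopy F c col G → MonoCopy F′ c col G
  widen (φ , φ-injective , edge) = φ , φ-injective , λ i j g → Product.map₁ (F⊆F′ (φ i) (φ j)) (edge i j g)

¬small-K-arrows : ∀ {m n s} → s < n → ¬ Arrows (K s) (Star (suc m)) (P n)
¬small-K-arrows s<n arrows with arrows (λ _ _ → blue) (λ _ _ → refl)
... | inj₁ (_ , _ , edge) with () ← proj₂ (edge fzero (fsuc fzero) (inj₁ (refl , λ ())))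
... | inj₂ (_ , φ-injective , _) = <⇒≱ s<n (injective⇒≤ φ-injective)

KminusP? : ∀ r k → B.Decidable (KminusP r k)
KminusP? r k u v = ¬? (u ≟ v) ×-dec ¬? (toℕ u <? k ×-dec toℕ v <? k ×-dec consec?)
  where
  consec? : Dec (Consec (toℕ u) (toℕ v))
  consec? = (suc (toℕ u) ℕ.≟ toℕ v) ⊎-dec (suc (toℕ v) ℕ.≟ toℕ u)

KminusP-sym : ∀ {r k} → Symmetric (KminusP r k)
KminusP-sym (u≢v , ¬uv) = u≢v ∘ sym , λ (v<k , u<k , consec) → ¬uv (u<k , v<k , Sum.swap consec)

KminusP-irrefl : ∀ {r k} → Irreflexive _≡_ (KminusP r k)
KminusP-irrefl u≡v (u≢v , _) = u≢v u≡v

KminusP⊆K : ∀ {r k} u v → KminusP r k u v → K r u v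
KminusP⊆K _ _ = proj₁

sole-candidate : ∀ {n} {P : Pred (Fin n) ℓ} → U.Decidable P → (∀ {v w} → P v → P w → v ≡ w) →
                 Fin n → ∃ λ a → ∀ {v} → P v → a ≡ v
sole-candidate P? P-unique default with any? P?
... | yes (a , pa) = a , P-unique pa
... | no none      = default , λ pv → contradiction (_ , pv) none

-- a and b are the successor and the predecessor of u on the deleted path, when these exist.
KminusP-nonNeighbours : ∀ r k → AtMostTwoNonNeighbours (KminusP r k)
KminusP-nonNeighbours r k u
  with a , a-only ← sole-candidate (λ v → suc (toℕ u) ℕ.≟ toℕ v) (λ p q → toℕ-injective (trans (sym p) q)) u
  with b , b-only ← sole-candidate (λ v → suc (toℕ v) ℕ.≟ toℕ u)
                      (λ p q → toℕ-injective (suc-injective (trans p (sym q)))) u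
  = a , b , λ v u≢v a≢v b≢v → u≢v , λ where
      (_ , _ , inj₁ u→v) → a≢v (a-only u→v)
      (_ , _ , inj₂ v→u) → b≢v (b-only v→u)

theorem4 : (m n : ℕ) → 1 ≤ m → 2 * m + 3 ≤ n →
    IsPathCriticalRamsey (Star m) (P n) n
theorem4 (suc m) n _ big =
  n , (Arrows-⊆ KminusP⊆K Kₙ∖Pₙ-arrows , λ s s<n → ¬small-K-arrows s<n) , ≤-refl , Kₙ∖Pₙ-arrows ,
  λ k n<k k≤n _ → <⇒≱ n<k k≤n
  where
  Kₙ∖Pₙ-arrows : Arrows (KminusP n n) (Star (suc m)) (P n)
  Kₙ∖Pₙ-arrows = star-path-arrows (KminusP? n n) KminusP-sym KminusP-irrefl (KminusP-nonNeighbours n n) big
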